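{- Let $G$ be a graph and $C(G)$ its central graph, with $V_1=V(G)$. If $\psi\in Aut(C(G))$ satisfies $\psi(u)=u$ for all $u\in V_1$, then $\psi$ is the identity automorphism of $C(G)$.
   Context: All graphs are simple, finite, undirected. The central graph $C(G)$ has vertex set $V(G)\cup\{w_{u,v}:\{u,v\}\in E(G)\}$ and edge set consisting of all pairs of distinct non-adjacent vertices of $G$, together with $\{u,w_{u,v}\}$ and $\{w_{u,v},v\}$ for every $\{u,v\}\in E(G)$. -}

module Defs where

open import Data.Nat using (ℕ)
open import Data.Fin using (Fin; _<_)
open import Data.Bool using (Bool; true; false)
open import Data.Empty using (⊥)
open import Data.Sum using (_⊎_; inj₁; inj₂)
open import Data.Product using (Σ; Σ-syntax; _×_; _,_)
open import Relation.Binary.PropositionalEquality using (_≡_; _≢_)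
open import Function.Bundles using (_⤖_; Bijection; _⇔_)

record Graph : Set where
  field
    n      : ℕ
    adj    : Fin n → Fin n → Bool
    sym    : ∀ u v → adj u v ≡ adj v u
    irrefl : ∀ u → adj u u ≡ false
open Graph public

-- Edges of G: each unordered edge {u,v} is represented once, as (u , v) with u < v.
Edge : Graph → Set
Edge G = Σ[ u ∈ Fin (n G) ] Σ[ v ∈ Fin (n G) ] (u < v × adj G u v ≡ true)

-- Vertices of the central graph C(G): V(G) ⊎ { w_{u,v} : {u,v} ∈ E(G) }.
CVertex : Graph → Set
CVertex G = Fin (n G) ⊎ Edge G

CAdj : (G : Graph) → CVertex G → CVertex G → Set
CAdj G (inj₁ x) (inj₁ y) = x ≢ y × adj G x y ≡ false
CAdj G (inj₁ x) (inj₂ (u , v , _)) = x ≡ u ⊎ x ≡ v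
CAdj G (inj₂ (u , v , _)) (inj₁ x) = x ≡ u ⊎ x ≡ v
CAdj G (inj₂ _) (inj₂ _) = ⊥

record CAut (G : Graph) : Set where
  field
    bij      : CVertex G ⤖ CVertex G
    preserve : ∀ x y → CAdj G x y ⇔ CAdj G (Bijection.to bij x) (Bijection.to bij y)
open CAut public

apply : {G : Graph} → CAut G → CVertex G → CVertex G
apply ψ = Bijection.to (bij ψ)

{-# OPTIONS --safe #-}
module Submission where

open import Defs hiding (sym)
open import Data.Sum using (inj₁; inj₂)
open import Data.Product using (_,_)
open import Data.Bool using (true)
open import Data.Bool.Properties using () renaming (_≟_ to _≟ᵇ_)
open import Data.Empty using (⊥-elim)
open import Data.Fin using (Fin; _<_)
open import Data.Fin.Properties using (<-irrefl; <-asym; <-irrelevant)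
open import Axiom.UniquenessOfIdentityProofs using (module Decidable⇒UIP)
open import Relation.Binary.PropositionalEquality using (_≡_; _≢_; refl; sym; trans; cong; subst)
open import Function.Bundles using (Bijection; Equivalence)

-- An automorphism ψ fixing V(G) pointwise cannot send a subdivision vertex
-- w_{u,v} into V(G), by injectivity. So ψ(w_{u,v}) = w_{u',v'}, which is
-- adjacent to ψ(u) = u and ψ(v) = v; hence {u',v'} = {u,v}.

edge-evidence-irrelevant : {G : Graph} {u v : Fin (n G)} (u<v u<v′ : u < v) (p p′ : adj G u v ≡ true) →
  _≡_ {A = Edge G} (u , v , u<v , p) (u , v , u<v′ , p′)
edge-evidence-irrelevant u<v u<v′ p p′
  rewrite <-irrelevant u<v u<v′ | Decidable⇒UIP.≡-irrelevant _≟ᵇ_ p p′ = refl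

edge-determined-by-neighbours : (G : Graph) (e e′ : Edge G) →
  (∀ x → CAdj G (inj₁ x) (inj₂ e) → CAdj G (inj₁ x) (inj₂ e′)) → e′ ≡ e
edge-determined-by-neighbours G (u , v , u<v , p) (_ , _ , u′<v′ , p′) sub
  with sub u (inj₁ refl) | sub v (inj₂ refl)
... | inj₁ refl | inj₁ refl = ⊥-elim (<-irrefl refl u<v)
... | inj₁ refl | inj₂ refl = edge-evidence-irrelevant {G} u′<v′ u<v p′ p
... | inj₂ refl | inj₁ refl = ⊥-elim (<-asym u<v u′<v′)
... | inj₂ refl | inj₂ refl = ⊥-elim (<-irrefl refl u<v)

module _ {G : Graph} (ψ : CAut G) where

  apply-injective : ∀ {x y} → apply ψ x ≡ apply ψ y → x ≡ y
  apply-injective = Bijection.injective (bij ψ)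

  fixed-vertex-keeps-neighbours : ∀ {x} → apply ψ (inj₁ x) ≡ inj₁ x →
    ∀ y → CAdj G (inj₁ x) y → CAdj G (inj₁ x) (apply ψ y)
  fixed-vertex-keeps-neighbours ψx≡x y x~y =
    subst (λ z → CAdj G z (apply ψ y)) ψx≡x (Equivalence.to (preserve ψ (inj₁ _) y) x~y)

  fixed-vertex-has-no-subdivision-preimage : ∀ {x} → apply ψ (inj₁ x) ≡ inj₁ x →
    ∀ e → apply ψ (inj₂ e) ≢ inj₁ x
  fixed-vertex-has-no-subdivision-preimage ψx≡x e ψe≡x
    with apply-injective (trans ψe≡x (sym ψx≡x))
  ... | ()

lemma2p3 : (G : Graph) (ψ : CAut G) →
    (∀ u → apply ψ (inj₁ u) ≡ inj₁ u) →
    ∀ x → apply ψ x ≡ x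
lemma2p3 G ψ fix (inj₁ u) = fix u
lemma2p3 G ψ fix (inj₂ e) with apply ψ (inj₂ e) in ψe≡
... | inj₁ x = ⊥-elim (fixed-vertex-has-no-subdivision-preimage ψ (fix x) e ψe≡)
... | inj₂ e′ = cong inj₂ (edge-determined-by-neighbours G e e′ e′-has-neighbours-of-e)
  where
  e′-has-neighbours-of-e : ∀ x → CAdj G (inj₁ x) (inj₂ e) → CAdj G (inj₁ x) (inj₂ e′)
  e′-has-neighbours-of-e x x~e =
    subst (CAdj G (inj₁ x)) ψe≡ (fixed-vertex-keeps-neighbours ψ (fix x) (inj₂ e) x~e)
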